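{- For every $n\in\mathbb{N}$ the graph $G(5,n)$ has a Hamiltonian path, and for every even $n>2$ the graph $G(5,n)$ is Hamiltonian (has a Hamiltonian cycle).
   Context: For a prime $p$ and $n\in\mathbb{N}$, $G(p,n)$ is the simple graph with vertex set $\{2,4,\ldots,2n\}$ in which two distinct vertices $a,b$ are adjacent if and only if both $\frac{a+b}{2}$ and $\frac{|a-b|}{2}$ are odd positive integers neither of which equals $pk$ for an integer $k\ge 2$. -}

module Defs where

open import Data.Nat using (ℕ; _+_; _*_; _≤_; _<_; ∣_-_∣; _/_)
open import Data.Nat.Divisibility using (_∣_)
open import Data.Product using (_×_; ∃-syntax)
open import Data.List using (List; []; _∷_; _++_; [_])
open import Data.List.Membership.Propositional using (_∈_)
open import Data.List.Relation.Unary.All using (All)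
open import Data.List.Relation.Unary.Unique.Propositional using (Unique)
open import Data.List.Relation.Unary.Linked using (Linked)
open import Relation.Binary.PropositionalEquality using (_≡_; _≢_)
open import Relation.Nullary using (¬_)

Odd : ℕ → Set
Odd m = ¬ (2 ∣ m)

NotProperMultiple : ℕ → ℕ → Set
NotProperMultiple p m = ¬ (∃[ k ] (2 ≤ k × m ≡ p * k))

IsVertex : ℕ → ℕ → Set
IsVertex n a = 2 ∣ a × 2 ≤ a × a ≤ 2 * n

-- adjacency in G(p,n) (vertices are even, so (a+b)/2 and |a-b|/2 are exact)
Adj : ℕ → ℕ → ℕ → Set
Adj p a b =
  a ≢ b ×
  Odd ((a + b) / 2) × 0 < (a + b) / 2 × NotProperMultiple p ((a + b) / 2) ×
  Odd (∣ a - b ∣ / 2) × 0 < ∣ a - b ∣ / 2 × NotProperMultiple p (∣ a - b ∣ / 2)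

IsHamiltonianPath : ℕ → ℕ → List ℕ → Set
IsHamiltonianPath p n xs =
  All (IsVertex n) xs × Unique xs ×
  (∀ a → IsVertex n a → a ∈ xs) ×
  Linked (Adj p) xs

HasHamiltonianPath : ℕ → ℕ → Set
HasHamiltonianPath p n = ∃[ xs ] IsHamiltonianPath p n xs

HasHamiltonianCycle : ℕ → ℕ → Set
HasHamiltonianCycle p n =
  ∃[ x ] ∃[ xs ] (IsHamiltonianPath p n (x ∷ xs) × Linked (Adj p) (x ∷ xs ++ [ x ]))

-- Write x for the vertex 2x. Then 2x and 2y are adjacent in G(5,n) exactly when x + y and |x - y| are
-- each coprime to 10 or equal to 5. Call the edge periodic when x + y is coprime to 10 (the sum 5 is
-- excluded, since 25 is a proper multiple of 5): periodic edges survive translating both ends by 10.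
-- So if L is a periodic Hamiltonian path on 1..n starting at 1, and D is a periodic path through 3..10
-- whose first vertex is adjacent to 10 + (last of L) and to 10 + (last of D), then 1, 2, L + 10, D is
-- again such a path, on 1..n+10. Explicit paths for 10 ≤ n < 20 thus propagate to all n ≥ 10, and n < 10
-- is checked directly. For even n the block D ends at 6, which is adjacent to 1 and closes a cycle.
module Submission where

open import Defs
open import Data.Nat using (ℕ; zero; suc; z≤n; s≤s; z<s; _+_; _*_; _<_; _≤_; ∣_-_∣; _/_; _%_)
open import Data.Nat.Properties
open import Data.Nat.Divisibility using (_∣_; _∣?_; divides; divides-refl; _∣0; ∣-refl; m∣m*n; %-presˡ-∣)
open import Data.Nat.DivMod using (m*n/n≡m; m≡m%n+[m/n]*n; m%n<n)
open import Data.Nat.Coprimality using (Coprime; coprime?; coprime-+)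
open import Data.Nat.GeneralisedArithmetic using (fold)
open import Data.Product using (_×_; _,_; ∃-syntax)
open import Data.Sum using (_⊎_; inj₁; inj₂)
open import Data.Maybe using (just)
import Data.Maybe as Maybe
import Data.Maybe.Properties as Maybe
open import Data.Maybe.Relation.Binary.Connected using (Connected; just; connected?)
open import Data.List using (List; []; _∷_; _++_; [_]; map; applyUpTo; head; last)
import Data.List.Properties as List
open import Data.List.Membership.Propositional using (_∈_)
open import Data.List.Membership.Propositional.Properties using (∈-map⁺; ∈-applyUpTo⁺; ∈-applyUpTo⁻)
import Data.List.Relation.Unary.All as All
import Data.List.Relation.Unary.All.Properties as All
open import Data.List.Relation.Unary.Unique.Propositional using (Unique)
import Data.List.Relation.Unary.Unique.Propositional.Properties as Unique
open import Data.List.Relation.Unary.Linked as Linked using (Linked; [-]; _∷_; _∷′_; linked?)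
import Data.List.Relation.Unary.Linked.Properties as Linked
open import Data.List.Relation.Binary.Permutation.Propositional
  using (_↭_; ↭-sym; ↭-trans; ↭-reflexive; ↭⇒↭ₛ; module PermutationReasoning)
import Data.List.Relation.Binary.Permutation.Propositional.Properties as ↭
open import Data.List.Sort.InsertionSort.Base ≤-decTotalOrder using (sort)
open import Data.List.Sort.InsertionSort.Properties ≤-decTotalOrder using (sort-↭)
open import Function using (_∘_)
open import Relation.Binary using (Decidable)
open import Relation.Binary.PropositionalEquality
  using (_≡_; _≢_; refl; sym; trans; cong; subst; setoid; module ≡-Reasoning)
open import Data.List.Relation.Binary.Permutation.Setoid.Properties (setoid ℕ) using (Unique-resp-↭)
open import Relation.Nullary using (Dec; yes; no; contradiction)
open import Relation.Nullary.Decidable using (from-yes; from-no; _×-dec_; _⊎-dec_; _→-dec_)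

Allowed : ℕ → ℕ → Set
Allowed p m = Odd m × 0 < m × NotProperMultiple p m

adj-intro : ∀ {p a b} → a ≢ b → Allowed p ((a + b) / 2) → Allowed p (∣ a - b ∣ / 2) → Adj p a b
adj-intro a≢b (s-odd , s-pos , s-npm) d = a≢b , s-odd , s-pos , s-npm , d

half-double : ∀ m → 2 * m / 2 ≡ m
half-double m = trans (cong (_/ 2) (*-comm 2 m)) (m*n/n≡m m 2)

double-adj : ∀ p x y → Allowed p (x + y) → Allowed p ∣ x - y ∣ → Adj p (2 * x) (2 * y)
double-adj p x y s d@(_ , d-pos , _) =
  adj-intro {p} 2x≢2y (halve (*-distribˡ-+ 2 x y) s) (halve (*-distribˡ-∣-∣ 2 x y) d)
  where
  halve : ∀ {m n} → 2 * m ≡ n → Allowed p m → Allowed p (n / 2)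
  halve {m} refl = subst (Allowed p) (sym (half-double m))
  2x≢2y : 2 * x ≢ 2 * y
  2x≢2y 2x≡2y = <⇒≢ d-pos (sym (m≡n⇒∣m-n∣≡0 (*-cancelˡ-≡ x y 2 2x≡2y)))

Admissible : ℕ → Set
Admissible m = Coprime m 10 ⊎ m ≡ 5

coprime-10⇒allowed : ∀ {m} → Coprime m 10 → Allowed 5 m
coprime-10⇒allowed {m} m⊥10 = odd , n≢0⇒n>0 m≢0 , not-proper-multiple
  where
  odd : Odd m
  odd 2∣m = contradiction (m⊥10 (2∣m , divides 5 refl)) λ ()
  m≢0 : m ≢ 0
  m≢0 refl = contradiction (m⊥10 (10 ∣0 , ∣-refl)) λ ()
  not-proper-multiple : NotProperMultiple 5 m
  not-proper-multiple (k , _ , refl) = contradiction (m⊥10 (m∣m*n {5} k , divides 2 refl)) λ ()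

five-allowed : Allowed 5 5
five-allowed = from-no (2 ∣? 5) , z<s , λ (k , 2≤k , 5≡5k) →
  contradiction (*-cancelˡ-≡ 1 k 5 5≡5k) λ { refl → from-no (2 ≤? 1) 2≤k }

admissible⇒allowed : ∀ {m} → Admissible m → Allowed 5 m
admissible⇒allowed (inj₁ m⊥10) = coprime-10⇒allowed m⊥10
admissible⇒allowed (inj₂ refl) = five-allowed

HalfAdj : ℕ → ℕ → Set
HalfAdj x y = Admissible (x + y) × Admissible ∣ x - y ∣

halfAdj⇒adj : ∀ {x y} → HalfAdj x y → Adj 5 (2 * x) (2 * y)
halfAdj⇒adj {x} {y} (s , d) = double-adj 5 x y (admissible⇒allowed s) (admissible⇒allowed d)

PeriodicAdj : ℕ → ℕ → Set
PeriodicAdj x y = Coprime (x + y) 10 × Admissible ∣ x - y ∣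

periodic⇒halfAdj : ∀ {x y} → PeriodicAdj x y → HalfAdj x y
periodic⇒halfAdj (s , d) = inj₁ s , d

periodic-shift : ∀ {x y} → PeriodicAdj x y → PeriodicAdj (10 + x) (10 + y)
periodic-shift {x} {y} (s , d) = subst (λ m → Coprime m 10) (sym shifted-sum) (coprime-+ (coprime-+ s)) , d
  where
  shifted-sum : (10 + x) + (10 + y) ≡ 10 + (10 + (x + y))
  shifted-sum = cong (10 +_) (trans (+-comm x (10 + y)) (cong (10 +_) (+-comm y x)))

admissible? : ∀ m → Dec (Admissible m)
admissible? m = coprime? m 10 ⊎-dec (m ≟ 5)

halfAdj? : Decidable HalfAdj
halfAdj? x y = admissible? (x + y) ×-dec admissible? ∣ x - y ∣

periodicAdj? : Decidable PeriodicAdj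
periodicAdj? x y = coprime? (x + y) 10 ×-dec admissible? ∣ x - y ∣

periodic-linked⇒halfAdj : ∀ {L} → Linked PeriodicAdj L → Linked HalfAdj L
periodic-linked⇒halfAdj = Linked.map (λ {x} {y} → periodic⇒halfAdj {x} {y})

double-linked : ∀ {L} → Linked HalfAdj L → Linked (Adj 5) (map (2 *_) L)
double-linked = Linked.map⁺ ∘ Linked.map (λ {x} {y} → halfAdj⇒adj {x} {y})

interval : ℕ → List ℕ
interval n = applyUpTo suc n

∈-interval : ∀ {n k} → 1 ≤ k → k ≤ n → k ∈ interval n
∈-interval {k = suc i} _ i<n = ∈-applyUpTo⁺ suc i<n

interval-bounds : ∀ {n k} → k ∈ interval n → 1 ≤ k × k ≤ n
interval-bounds k∈ with ∈-applyUpTo⁻ suc k∈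
... | _ , i<n , refl = s≤s z≤n , i<n

interval-unique : ∀ n → Unique (interval n)
interval-unique n = Unique.applyUpTo⁺₁ suc n (λ i<j _ → <⇒≢ i<j ∘ suc-injective)

sort≡⇒↭ : ∀ {L M} → sort L ≡ M → L ↭ M
sort≡⇒↭ {L} sorted = ↭-trans (↭-sym (sort-↭ L)) (↭-reflexive sorted)

double-isHamiltonianPath : ∀ {n L} → L ↭ interval n → Linked HalfAdj L → IsHamiltonianPath 5 n (map (2 *_) L)
double-isHamiltonianPath {n} {L} L↭ linked =
  All.map⁺ (All.tabulate (vertex ∘ interval-bounds ∘ ↭.∈-resp-↭ L↭)) ,
  Unique.map⁺ (*-cancelˡ-≡ _ _ 2) (Unique-resp-↭ (↭⇒↭ₛ (↭-sym L↭)) (interval-unique n)) ,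
  covers ,
  double-linked linked
  where
  vertex : ∀ {k} → 1 ≤ k × k ≤ n → IsVertex n (2 * k)
  vertex {k} (1≤k , k≤n) = m∣m*n k , *-monoʳ-≤ 2 1≤k , *-monoʳ-≤ 2 k≤n
  covers : ∀ a → IsVertex n a → a ∈ map (2 *_) L
  covers _ (divides-refl zero , () , _)
  covers _ (divides-refl k@(suc _) , _ , k*2≤2*n) =
    subst (_∈ map (2 *_) L) (*-comm 2 k)
      (∈-map⁺ (2 *_) (↭.∈-resp-↭ (↭-sym L↭)
        (∈-interval (s≤s z≤n) (*-cancelˡ-≤ 2 (subst (_≤ 2 * n) (*-comm k 2) k*2≤2*n)))))

double-hasHamiltonianCycle : ∀ {n x L} → L ↭ interval n → Linked HalfAdj L → head L ≡ just x →
                             Connected HalfAdj (last L) (just x) → HasHamiltonianCycle 5 n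
double-hasHamiltonianCycle {x = x} {L = x ∷ xs} L↭ linked refl closes =
  2 * x , map (2 *_) xs , double-isHamiltonianPath L↭ linked ,
  subst (Linked (Adj 5)) (List.map-++ (2 *_) (x ∷ xs) [ x ]) (double-linked (Linked.++⁺ linked closes [-]))

extend : List ℕ → List ℕ → List ℕ
extend D L = 1 ∷ 2 ∷ map (10 +_) L ++ D

record Block (D : List ℕ) : Set where
  field
    enumerates : D ↭ applyUpTo (3 +_) 8
    linked     : Linked PeriodicAdj D
    rejoins    : Connected PeriodicAdj (Maybe.map (10 +_) (last D)) (head D)

record Extendable (D : List ℕ) (n : ℕ) (L : List ℕ) : Set where
  field
    enumerates : L ↭ interval n
    linked     : Linked PeriodicAdj L
    starts     : head L ≡ just 1
    joins      : Connected PeriodicAdj (Maybe.map (10 +_) (last L)) (head D)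

extend-↭ : ∀ {D L n} → D ↭ applyUpTo (3 +_) 8 → L ↭ interval n → extend D L ↭ interval (10 + n)
extend-↭ {D} {L} {n} D↭ L↭ = begin
  1 ∷ 2 ∷ map (10 +_) L ++ D                              <<⟨ ↭.++-comm (map (10 +_) L) D ⟩
  2 ∷ 1 ∷ D ++ map (10 +_) L                              <<⟨ ↭.++⁺ D↭ (↭.map⁺ (10 +_) L↭) ⟩
  1 ∷ 2 ∷ applyUpTo (3 +_) 8 ++ map (10 +_) (interval n)  ≡⟨ cong (λ xs → 1 ∷ 2 ∷ applyUpTo (3 +_) 8 ++ xs)
                                                                  (List.map-applyUpTo suc (10 +_) n) ⟩
  interval (10 + n)                                        ∎
  where open PermutationReasoning

extend-linked : ∀ {D L} → Linked PeriodicAdj D → Linked PeriodicAdj L → head L ≡ just 1 →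
                Connected PeriodicAdj (Maybe.map (10 +_) (last L)) (head D) → Linked PeriodicAdj (extend D L)
extend-linked {L = L@(_ ∷ _)} D-linked L-linked refl joins =
  from-yes (periodicAdj? 1 2) ∷
  Linked.++⁺ (just (from-yes (periodicAdj? 2 11)) ∷′ Linked.map⁺ (Linked.map periodic-shift L-linked))
             (subst (λ z → Connected PeriodicAdj z _) (sym (List.last-map (10 +_) L)) joins)
             D-linked

last-++-∷ : ∀ (xs : List ℕ) {y ys} → last (xs ++ y ∷ ys) ≡ last (y ∷ ys)
last-++-∷ []           = refl
last-++-∷ (_ ∷ [])     = refl
last-++-∷ (_ ∷ x ∷ xs) = last-++-∷ (x ∷ xs)

last-extend : ∀ {D} L → Block D → last (extend D L) ≡ last D
last-extend {[]}    _ block = contradiction (↭-sym (Block.enumerates block)) ↭.¬x∷xs↭[]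
last-extend {_ ∷ _} L _     = last-++-∷ (1 ∷ 2 ∷ map (10 +_) L)

extend-extendable : ∀ {D n L} → Block D → Extendable D n L → Extendable D (10 + n) (extend D L)
extend-extendable {L = L} block ext = record
  { enumerates = extend-↭ B.enumerates E.enumerates
  ; linked     = extend-linked B.linked E.linked E.starts E.joins
  ; starts     = refl
  ; joins      = subst (λ z → Connected PeriodicAdj (Maybe.map (10 +_) z) _) (sym (last-extend L block)) B.rejoins
  }
  where
  module B = Block block
  module E = Extendable ext

fold-extendable : ∀ {D n L} → Block D → Extendable D n L → ∀ q → Extendable D (q * 10 + n) (fold L (extend D) q)
fold-extendable block ext zero    = ext
fold-extendable block ext (suc q) = extend-extendable block (fold-extendable block ext q)

fold-closes : ∀ {R : ℕ → ℕ → Set} {D L} → Block D → Connected R (last D) (just 1) → Connected R (last L) (just 1) →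
              ∀ q → Connected R (last (fold L (extend D) q)) (just 1)
fold-closes block D-closes L-closes zero = L-closes
fold-closes {R} {L = L} block D-closes L-closes (suc q) =
  subst (λ z → Connected R z (just 1)) (sym (last-extend (fold L (extend _) q) block)) D-closes

evenBlock oddBlock : List ℕ
evenBlock = 3 ∷ 4 ∷ 5 ∷ 8 ∷ 9 ∷ 10 ∷ 7 ∷ 6 ∷ []
oddBlock  = 4 ∷ 3 ∷ 6 ∷ 5 ∷ 8 ∷ 9 ∷ 10 ∷ 7 ∷ []

evenBlock-isBlock : Block evenBlock
evenBlock-isBlock = record
  { enumerates = sort≡⇒↭ refl
  ; linked     = from-yes (linked? periodicAdj? evenBlock)
  ; rejoins    = just (from-yes (periodicAdj? 16 3))
  }

oddBlock-isBlock : Block oddBlock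
oddBlock-isBlock = record
  { enumerates = sort≡⇒↭ refl
  ; linked     = from-yes (linked? periodicAdj? oddBlock)
  ; rejoins    = just (from-yes (periodicAdj? 17 4))
  }

-- Edges join vertices of opposite parity, so a Hamiltonian path on 1..n with n odd starts and ends at
-- odd vertices; the block following it must then start at an even vertex.
block : ℕ → List ℕ
block r with 2 ∣? r
... | yes _ = evenBlock
... | no  _ = oddBlock

block-isBlock : ∀ r → Block (block r)
block-isBlock r with 2 ∣? r
... | yes _ = evenBlock-isBlock
... | no  _ = oddBlock-isBlock

block-closes : ∀ {r} → 2 ∣ r → Connected HalfAdj (last (block r)) (just 1)
block-closes {r} 2∣r with 2 ∣? r
... | yes _  = just (from-yes (halfAdj? 6 1))
... | no 2∤r = contradiction 2∣r 2∤r

smallPath : ℕ → List ℕ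
smallPath 0 = []
smallPath 1 = 1 ∷ []
smallPath 2 = 1 ∷ 2 ∷ []
smallPath 3 = 1 ∷ 2 ∷ 3 ∷ []
smallPath 4 = 1 ∷ 2 ∷ 3 ∷ 4 ∷ []
smallPath 5 = 1 ∷ 2 ∷ 3 ∷ 4 ∷ 5 ∷ []
smallPath 6 = 1 ∷ 2 ∷ 3 ∷ 4 ∷ 5 ∷ 6 ∷ []
smallPath 7 = 1 ∷ 2 ∷ 3 ∷ 4 ∷ 5 ∷ 6 ∷ 7 ∷ []
smallPath 8 = 1 ∷ 2 ∷ 3 ∷ 4 ∷ 7 ∷ 6 ∷ 5 ∷ 8 ∷ []
smallPath 9 = 1 ∷ 2 ∷ 3 ∷ 4 ∷ 7 ∷ 6 ∷ 5 ∷ 8 ∷ 9 ∷ []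
smallPath _ = []

basePath : ℕ → List ℕ
basePath 0 = 1 ∷ 2 ∷ 5 ∷ 4 ∷ 3 ∷ 8 ∷ 9 ∷ 10 ∷ 7 ∷ 6 ∷ []
basePath 1 = 1 ∷ 2 ∷ 5 ∷ 4 ∷ 3 ∷ 6 ∷ 11 ∷ 8 ∷ 9 ∷ 10 ∷ 7 ∷ []
basePath 2 = 1 ∷ 2 ∷ 5 ∷ 4 ∷ 3 ∷ 6 ∷ 7 ∷ 12 ∷ 9 ∷ 8 ∷ 11 ∷ 10 ∷ []
basePath 3 = 1 ∷ 2 ∷ 5 ∷ 4 ∷ 3 ∷ 6 ∷ 7 ∷ 10 ∷ 9 ∷ 12 ∷ 11 ∷ 8 ∷ 13 ∷ []
basePath 4 = 1 ∷ 2 ∷ 5 ∷ 4 ∷ 3 ∷ 6 ∷ 7 ∷ 12 ∷ 9 ∷ 14 ∷ 13 ∷ 8 ∷ 11 ∷ 10 ∷ []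
basePath 5 = 1 ∷ 2 ∷ 5 ∷ 4 ∷ 3 ∷ 6 ∷ 7 ∷ 10 ∷ 9 ∷ 8 ∷ 11 ∷ 12 ∷ 15 ∷ 14 ∷ 13 ∷ []
basePath 6 = 1 ∷ 2 ∷ 5 ∷ 4 ∷ 3 ∷ 6 ∷ 7 ∷ 12 ∷ 9 ∷ 8 ∷ 11 ∷ 16 ∷ 15 ∷ 14 ∷ 13 ∷ 10 ∷ []
basePath 7 = 1 ∷ 2 ∷ 5 ∷ 4 ∷ 3 ∷ 6 ∷ 7 ∷ 10 ∷ 9 ∷ 8 ∷ 11 ∷ 12 ∷ 15 ∷ 14 ∷ 17 ∷ 16 ∷ 13 ∷ []
basePath 8 = 1 ∷ 2 ∷ 5 ∷ 4 ∷ 3 ∷ 6 ∷ 7 ∷ 12 ∷ 9 ∷ 8 ∷ 11 ∷ 16 ∷ 13 ∷ 18 ∷ 15 ∷ 14 ∷ 17 ∷ 10 ∷ []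
basePath 9 = 1 ∷ 2 ∷ 5 ∷ 4 ∷ 3 ∷ 6 ∷ 7 ∷ 10 ∷ 9 ∷ 8 ∷ 11 ∷ 12 ∷ 15 ∷ 16 ∷ 17 ∷ 14 ∷ 19 ∷ 18 ∷ 13 ∷ []
basePath _ = []

SmallCase : ℕ → Set
SmallCase r =
  sort (smallPath r) ≡ interval r × Linked HalfAdj (smallPath r) ×
  (2 ∣ r → 2 < r → head (smallPath r) ≡ just 1 × Connected HalfAdj (last (smallPath r)) (just 1))

smallCase? : ∀ r → Dec (SmallCase r)
smallCase? r =
  List.≡-dec _≟_ (sort (smallPath r)) (interval r) ×-dec linked? halfAdj? (smallPath r) ×-dec
  (2 ∣? r →-dec 2 <? r →-dec
     Maybe.≡-dec _≟_ (head (smallPath r)) (just 1) ×-dec connected? halfAdj? (last (smallPath r)) (just 1))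

smallCase : ∀ {r} → r < 10 → SmallCase r
smallCase = from-yes (allUpTo? smallCase? 10)

BaseCase : ℕ → Set
BaseCase r =
  sort (basePath r) ≡ interval (10 + r) × Linked PeriodicAdj (basePath r) × head (basePath r) ≡ just 1 ×
  Connected PeriodicAdj (Maybe.map (10 +_) (last (basePath r))) (head (block r)) ×
  (2 ∣ r → Connected HalfAdj (last (basePath r)) (just 1))

baseCase? : ∀ r → Dec (BaseCase r)
baseCase? r =
  List.≡-dec _≟_ (sort (basePath r)) (interval (10 + r)) ×-dec linked? periodicAdj? (basePath r) ×-dec
  Maybe.≡-dec _≟_ (head (basePath r)) (just 1) ×-dec
  connected? periodicAdj? (Maybe.map (10 +_) (last (basePath r))) (head (block r)) ×-dec
  (2 ∣? r →-dec connected? halfAdj? (last (basePath r)) (just 1))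

baseCase : ∀ {r} → r < 10 → BaseCase r
baseCase = from-yes (allUpTo? baseCase? 10)

base-extendable : ∀ {r} → r < 10 → Extendable (block r) (10 + r) (basePath r)
base-extendable r<10 with baseCase r<10
... | sorted , linked , starts , joins , _ = record
  { enumerates = sort≡⇒↭ sorted ; linked = linked ; starts = starts ; joins = joins }

base-closes : ∀ {r} → r < 10 → 2 ∣ r → Connected HalfAdj (last (basePath r)) (just 1)
base-closes r<10 with baseCase r<10
... | _ , _ , _ , _ , closes = closes

longPath : ℕ → ℕ → List ℕ
longPath q r = fold (basePath r) (extend (block r)) q

longPath-extendable : ∀ q {r} → r < 10 → Extendable (block r) (q * 10 + (10 + r)) (longPath q r)
longPath-extendable q {r} r<10 = fold-extendable (block-isBlock r) (base-extendable r<10) q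

longPath-closes : ∀ q {r} → r < 10 → 2 ∣ r → Connected HalfAdj (last (longPath q r)) (just 1)
longPath-closes q {r} r<10 2∣r = fold-closes (block-isBlock r) (block-closes 2∣r) (base-closes r<10 2∣r) q

small-hasHamiltonianPath : ∀ {r} → r < 10 → HasHamiltonianPath 5 r
small-hasHamiltonianPath r<10 with smallCase r<10
... | sorted , linked , _ = _ , double-isHamiltonianPath (sort≡⇒↭ sorted) linked

small-hasHamiltonianCycle : ∀ {r} → r < 10 → 2 ∣ r → 2 < r → HasHamiltonianCycle 5 r
small-hasHamiltonianCycle r<10 2∣r 2<r with smallCase r<10
... | sorted , linked , cycle with cycle 2∣r 2<r
...   | starts , closes = double-hasHamiltonianCycle (sort≡⇒↭ sorted) linked starts closes

long-hasHamiltonianPath : ∀ q {r} → r < 10 → HasHamiltonianPath 5 (q * 10 + (10 + r))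
long-hasHamiltonianPath q r<10 = _ , double-isHamiltonianPath E.enumerates (periodic-linked⇒halfAdj E.linked)
  where module E = Extendable (longPath-extendable q r<10)

long-hasHamiltonianCycle : ∀ q {r} → r < 10 → 2 ∣ r → HasHamiltonianCycle 5 (q * 10 + (10 + r))
long-hasHamiltonianCycle q r<10 2∣r =
  double-hasHamiltonianCycle E.enumerates (periodic-linked⇒halfAdj E.linked) E.starts (longPath-closes q r<10 2∣r)
  where module E = Extendable (longPath-extendable q r<10)

small⊎long : ∀ n → n < 10 ⊎ ∃[ q ] n ≡ q * 10 + (10 + n % 10)
small⊎long n with n / 10 | m≡m%n+[m/n]*n n 10
... | zero  | n≡r+0       = inj₁ (subst (_< 10) (sym (trans n≡r+0 (+-identityʳ _))) (m%n<n n 10))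
... | suc q | n≡r+10+q*10 = inj₂ (q , trans n≡r+10+q*10 rearrange)
  where
  open ≡-Reasoning
  r = n % 10
  rearrange : r + (10 + q * 10) ≡ q * 10 + (10 + r)
  rearrange = begin
    r + (10 + q * 10) ≡⟨ +-comm r (10 + q * 10) ⟩
    (10 + q * 10) + r ≡⟨ cong (_+ r) (+-comm 10 (q * 10)) ⟩
    (q * 10 + 10) + r ≡⟨ +-assoc (q * 10) 10 r ⟩
    q * 10 + (10 + r) ∎

theorem5p5 : ((n : ℕ) → HasHamiltonianPath 5 n) ×
             ((n : ℕ) → 2 ∣ n → 2 < n → HasHamiltonianCycle 5 n)
theorem5p5 = hasHamiltonianPath , hasHamiltonianCycle
  where
  hasHamiltonianPath : ∀ n → HasHamiltonianPath 5 n
  hasHamiltonianPath n with small⊎long n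
  ... | inj₁ n<10     = small-hasHamiltonianPath n<10
  ... | inj₂ (q , n≡) = subst (HasHamiltonianPath 5) (sym n≡) (long-hasHamiltonianPath q (m%n<n n 10))

  hasHamiltonianCycle : ∀ n → 2 ∣ n → 2 < n → HasHamiltonianCycle 5 n
  hasHamiltonianCycle n 2∣n 2<n with small⊎long n
  ... | inj₁ n<10     = small-hasHamiltonianCycle n<10 2∣n 2<n
  ... | inj₂ (q , n≡) = subst (HasHamiltonianCycle 5) (sym n≡)
                          (long-hasHamiltonianCycle q (m%n<n n 10) (%-presˡ-∣ 2∣n (divides 5 refl)))
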